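{- Let $G=(V,E)$ be a finite connected graph with $n=|V|$ admitting a solution $K:V\to\mathbb R_{\ge 0}$ of $\sum_{y\in V}d(x,y)K(y)=n$ for all $x\in V$. Then $$d^\#(G)\le\frac{1}{\min_{x\in V}K(x)},$$ and equality holds if and only if $K$ is constant.
   Context: $d(x,y)$ is the graph distance. The average distance of $G$ is $d^\#(G)=\frac{1}{|V|^2}\sum_{x,y\in V}d(x,y)$. -}

module Defs where

open import Level using (Level; _⊔_) renaming (suc to lsuc)
open import Data.Bool using (Bool; true; false; T; _∧_; _∨_; if_then_else_)
open import Data.Nat using (ℕ; zero; suc)
open import Data.Fin using (Fin; zero; suc)
open import Data.Fin.Properties using (_≟_)
open import Data.Sum using (_⊎_; inj₁; inj₂)
open import Relation.Nullary using (¬_)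
open import Relation.Nullary.Decidable using (⌊_⌋)
open import Relation.Binary using (Rel)
open import Relation.Binary.Structures using (IsTotalOrder)
open import Relation.Binary.Construct.Closure.ReflexiveTransitive using (Star)
open import Relation.Binary.PropositionalEquality using (_≡_)
open import Algebra.Bundles using (CommutativeRing)

-- Ordered fields (the real numbers ℝ are one instance).  The theorem is
-- stated for every ordered field, hence in particular for ℝ.

record OrderedField (c ℓ : Level) : Set (lsuc (c ⊔ ℓ)) where
  field
    commutativeRing : CommutativeRing c ℓ
  open CommutativeRing commutativeRing public hiding (zero)
  field
    _≤_          : Rel Carrier ℓ
    isTotalOrder : IsTotalOrder _≈_ _≤_
    +-monoˡ-≤    : ∀ {x y} z → x ≤ y → (x + z) ≤ (y + z)
    *-nonneg     : ∀ {x y} → 0# ≤ x → 0# ≤ y → 0# ≤ (x * y)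
    0≉1          : ¬ (0# ≈ 1#)
    _⁻¹          : Carrier → Carrier
    inverseʳ     : ∀ x → ¬ (x ≈ 0#) → (x * (x ⁻¹)) ≈ 1#

  open IsTotalOrder isTotalOrder public using (total)

  fromℕ : ℕ → Carrier
  fromℕ zero    = 0#
  fromℕ (suc k) = 1# + fromℕ k

  Σ : (n : ℕ) → (Fin n → Carrier) → Carrier
  Σ zero    f = 0#
  Σ (suc n) f = f zero + Σ n (λ i → f (suc i))

  min₂ : Carrier → Carrier → Carrier
  min₂ x y with total x y
  ... | inj₁ _ = x
  ... | inj₂ _ = y

  minimum : (n : ℕ) → (Fin (suc n) → Carrier) → Carrier
  minimum zero    f = f zero
  minimum (suc n) f = min₂ (f zero) (minimum n (λ i → f (suc i)))

record Graph (n : ℕ) : Set where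
  field
    adj     : Fin n → Fin n → Bool
    symm    : ∀ x y → adj x y ≡ adj y x
    irrefl  : ∀ x → adj x x ≡ false

module _ {n : ℕ} (G : Graph n) where
  open Graph G

  Adj : Fin n → Fin n → Set
  Adj x y = T (adj x y)

  Connected : Set
  Connected = ∀ x y → Star Adj x y

  anyFin : (m : ℕ) → (Fin m → Bool) → Bool
  anyFin zero    p = false
  anyFin (suc m) p = p zero ∨ anyFin m (λ i → p (suc i))

  reach : ℕ → Fin n → Fin n → Bool
  reach zero    x y = ⌊ x ≟ y ⌋
  reach (suc k) x y = ⌊ x ≟ y ⌋ ∨ anyFin n (λ z → adj x z ∧ reach k z y)

  least : (ℕ → Bool) → ℕ → ℕ → ℕ
  least p start zero       = start
  least p start (suc fuel) = if p start then start else least p (suc start) fuel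

  -- graph distance d(x,y): least length of a walk from x to y
  -- (every shortest walk has length < n, so searching k = 0 … n suffices)
  dist : Fin n → Fin n → ℕ
  dist x y = least (λ k → reach k x y) 0 n

module _ {c ℓ} (F : OrderedField c ℓ) where
  open OrderedField F

  avgDist : ∀ {n} → Graph n → Carrier
  avgDist {n} G = Σ n (λ x → Σ n (λ y → fromℕ (dist G x y))) * ((fromℕ n * fromℕ n) ⁻¹)

  IsConstant : ∀ {n} → (Fin n → Carrier) → Set ℓ
  IsConstant {n} K = ∀ x y → K x ≈ K y

-- Summing the equations Σ_y d(x,y) K(y) = n over x gives Σ_{x,y} d(x,y) K(y) = n².
-- With k = min K and column sums D(y) = Σ_x d(x,y) this double sum splits as
-- k · Σ_{x,y} d(x,y) + Σ_y D(y) (K(y) - k), whose second part is nonnegative; hence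
-- n² d#(G) k ≤ n².  Equality forces every D(y) (K(y) - k) to vanish, and D(y) ≥ 1
-- since some other vertex lies at distance ≥ 1 from y, so K is constantly k.
-- Of the distances, only their nonnegativity enters the inequality.

module Submission where

open import Defs
open import Data.Nat using (ℕ; zero; suc; s≤s; z≤n) renaming (_≤_ to _≤ℕ_; _<_ to _<ℕ_)
import Data.Nat.Properties as ℕ
open import Data.Fin using (Fin; zero; suc; punchIn)
open import Data.Fin.Properties using (_≟_; punchInᵢ≢i)
open import Data.Bool using (true; false)
open import Data.Product using (_×_; _,_; ∃-syntax)
open import Data.Sum using (_⊎_; inj₁; inj₂)
open import Data.Empty using (⊥-elim)
open import Function.Bundles using (_⇔_; mk⇔)
open import Function.Properties.Equivalence using () renaming (trans to ⇔-trans)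
open import Relation.Nullary using (¬_)
open import Relation.Nullary.Decidable using (isYes≗does; dec-true; dec-false)
open import Relation.Binary.Bundles using (Poset)
open import Relation.Binary.Structures using (IsTotalOrder)
open import Relation.Binary.PropositionalEquality as ≡ using (_≡_; _≢_)
import Relation.Binary.Reasoning.PartialOrder as PartialOrderReasoning
import Relation.Binary.Reasoning.Setoid as SetoidReasoning
import Algebra.Properties.Ring as RingProperties
import Algebra.Properties.Group as GroupProperties
import Algebra.Properties.CommutativeSemigroup as CommutativeSemigroupProperties

module OrderedFieldProperties {c ℓ} (F : OrderedField c ℓ) where
  open OrderedField F
  open IsTotalOrder isTotalOrder public using ()
    renaming (refl to ≤-refl; reflexive to ≤-reflexive; trans to ≤-trans; antisym to ≤-antisym)
  open RingProperties ring using (x[y-z]≈xy-xz; -‿distribʳ-*)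
  open GroupProperties +-group using (//-rightDividesˡ; x∙y⁻¹≈ε⇒x≈y; identityˡ-unique)
  open CommutativeSemigroupProperties +-commutativeSemigroup using (interchange)

  poset : Poset c ℓ ℓ
  poset = record { isPartialOrder = IsTotalOrder.isPartialOrder isTotalOrder }

  module ≤-Reasoning = PartialOrderReasoning poset
  module ≈-Reasoning = SetoidReasoning setoid

  x-y+y≈x : ∀ x y → (x - y) + y ≈ x
  x-y+y≈x x y = //-rightDividesˡ y x

  x-y≈0⇒x≈y : ∀ {x y} → x - y ≈ 0# → x ≈ y
  x-y≈0⇒x≈y {x} {y} = x∙y⁻¹≈ε⇒x≈y x y

  x+y≈y⇒x≈0 : ∀ {x y} → x + y ≈ y → x ≈ 0#
  x+y≈y⇒x≈0 {x} {y} = identityˡ-unique x y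

  x≤y⇒0≤y-x : ∀ {x y} → x ≤ y → 0# ≤ (y - x)
  x≤y⇒0≤y-x {x} {y} x≤y = begin
    0#    ≈⟨ -‿inverseʳ x ⟨
    x - x ≤⟨ +-monoˡ-≤ (- x) x≤y ⟩
    y - x ∎
    where open ≤-Reasoning

  0≤y-x⇒x≤y : ∀ {x y} → 0# ≤ (y - x) → x ≤ y
  0≤y-x⇒x≤y {x} {y} 0≤y-x = begin
    x           ≈⟨ +-identityˡ x ⟨
    0# + x      ≤⟨ +-monoˡ-≤ x 0≤y-x ⟩
    (y - x) + x ≈⟨ x-y+y≈x y x ⟩
    y           ∎
    where open ≤-Reasoning

  x≤0⇒0≤-x : ∀ {x} → x ≤ 0# → 0# ≤ (- x)
  x≤0⇒0≤-x {x} x≤0 = ≤-trans (x≤y⇒0≤y-x x≤0) (≤-reflexive (+-identityˡ (- x)))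

  0≤-x⇒x≤0 : ∀ {x} → 0# ≤ (- x) → x ≤ 0#
  0≤-x⇒x≤0 {x} 0≤-x = 0≤y-x⇒x≤y (≤-trans 0≤-x (≤-reflexive (sym (+-identityˡ (- x)))))

  +-mono-≤ : ∀ {x y u v} → x ≤ y → u ≤ v → (x + u) ≤ (y + v)
  +-mono-≤ {x} {y} {u} {v} x≤y u≤v = begin
    x + u ≤⟨ +-monoˡ-≤ u x≤y ⟩
    y + u ≈⟨ +-comm y u ⟩
    u + y ≤⟨ +-monoˡ-≤ y u≤v ⟩
    v + y ≈⟨ +-comm v y ⟩
    y + v ∎
    where open ≤-Reasoning

  *-monoˡ-≤ : ∀ {z x y} → 0# ≤ z → x ≤ y → (z * x) ≤ (z * y)
  *-monoˡ-≤ {z} {x} {y} 0≤z x≤y = 0≤y-x⇒x≤y (begin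
    0#            ≤⟨ *-nonneg 0≤z (x≤y⇒0≤y-x x≤y) ⟩
    z * (y - x)   ≈⟨ x[y-z]≈xy-xz z y x ⟩
    z * y - z * x ∎)
    where open ≤-Reasoning

  *-monoʳ-≤ : ∀ {z x y} → 0# ≤ z → x ≤ y → (x * z) ≤ (y * z)
  *-monoʳ-≤ {z} {x} {y} 0≤z x≤y = begin
    x * z ≈⟨ *-comm x z ⟩
    z * x ≤⟨ *-monoˡ-≤ 0≤z x≤y ⟩
    z * y ≈⟨ *-comm z y ⟩
    y * z ∎
    where open ≤-Reasoning

  -- If 1 ≤ 0 then 0 ≤ -1, and 1 is the square (-1)(-1) ≥ 0.
  0≤1 : 0# ≤ 1#
  0≤1 with total 0# 1#
  ... | inj₁ 0≤1 = 0≤1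
  ... | inj₂ 1≤0 = begin
    0#              ≤⟨ *-nonneg 0≤-1 0≤-1 ⟩
    - 1# * - 1#     ≈⟨ -‿distribʳ-* (- 1#) 1# ⟨
    - (- 1# * 1#)   ≈⟨ -‿cong (*-identityʳ (- 1#)) ⟩
    - (- 1#)        ≈⟨ ⁻¹-involutive 1# ⟩
    1#              ∎
    where
    open ≤-Reasoning
    open GroupProperties +-group using (⁻¹-involutive)
    0≤-1 : 0# ≤ (- 1#)
    0≤-1 = x≤0⇒0≤-x 1≤0

  1≰0 : ¬ (1# ≤ 0#)
  1≰0 1≤0 = 0≉1 (≤-antisym 0≤1 1≤0)

  1≤x⇒x≉0 : ∀ {x} → 1# ≤ x → ¬ x ≈ 0#
  1≤x⇒x≉0 1≤x x≈0 = 1≰0 (≤-trans 1≤x (≤-reflexive x≈0))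

  0≤x⇒0≤x⁻¹ : ∀ {x} → 0# ≤ x → ¬ x ≈ 0# → 0# ≤ (x ⁻¹)
  0≤x⇒0≤x⁻¹ {x} 0≤x x≉0 with total 0# (x ⁻¹)
  ... | inj₁ 0≤x⁻¹ = 0≤x⁻¹
  ... | inj₂ x⁻¹≤0 = ⊥-elim (1≰0 (0≤-x⇒x≤0 (begin
    0#             ≤⟨ *-nonneg 0≤x (x≤0⇒0≤-x x⁻¹≤0) ⟩
    x * - (x ⁻¹)   ≈⟨ -‿distribʳ-* x (x ⁻¹) ⟨
    - (x * x ⁻¹)   ≈⟨ -‿cong (inverseʳ x x≉0) ⟩
    - 1#           ∎)))
    where open ≤-Reasoning

  *-cancelˡ-≈0 : ∀ {x y} → ¬ x ≈ 0# → x * y ≈ 0# → y ≈ 0#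
  *-cancelˡ-≈0 {x} {y} x≉0 xy≈0 = begin
    y                ≈⟨ *-identityˡ y ⟨
    1# * y           ≈⟨ *-congʳ (inverseʳ x x≉0) ⟨
    (x * x ⁻¹) * y   ≈⟨ *-congʳ (*-comm x (x ⁻¹)) ⟩
    (x ⁻¹ * x) * y   ≈⟨ *-assoc (x ⁻¹) x y ⟩
    x ⁻¹ * (x * y)   ≈⟨ *-congˡ xy≈0 ⟩
    x ⁻¹ * 0#        ≈⟨ zeroʳ (x ⁻¹) ⟩
    0#               ∎
    where open ≈-Reasoning

  0≤fromℕ : ∀ k → 0# ≤ fromℕ k
  0≤fromℕ zero    = ≤-refl
  0≤fromℕ (suc k) = ≤-trans (≤-reflexive (sym (+-identityˡ 0#))) (+-mono-≤ 0≤1 (0≤fromℕ k))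

  0<k⇒1≤fromℕ : ∀ {k} → 0 <ℕ k → 1# ≤ fromℕ k
  0<k⇒1≤fromℕ {suc k} _ = ≤-trans (≤-reflexive (sym (+-identityʳ 1#))) (+-mono-≤ ≤-refl (0≤fromℕ k))

  x≤y⇒x*y⁻¹≤1 : ∀ {x y} → 0# ≤ y → ¬ y ≈ 0# → x ≤ y → (x * y ⁻¹) ≤ 1#
  x≤y⇒x*y⁻¹≤1 {x} {y} 0≤y y≉0 x≤y = begin
    x * y ⁻¹ ≤⟨ *-monoʳ-≤ (0≤x⇒0≤x⁻¹ 0≤y y≉0) x≤y ⟩
    y * y ⁻¹ ≈⟨ inverseʳ y y≉0 ⟩
    1#       ∎
    where open ≤-Reasoning

  x*y⁻¹≈1⇔x≈y : ∀ {x y} → ¬ y ≈ 0# → (x * y ⁻¹ ≈ 1#) ⇔ (x ≈ y)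
  x*y⁻¹≈1⇔x≈y {x} {y} y≉0 = mk⇔ to from
    where
    open ≈-Reasoning
    to : x * y ⁻¹ ≈ 1# → x ≈ y
    to xy⁻¹≈1 = begin
      x                ≈⟨ *-identityʳ x ⟨
      x * 1#           ≈⟨ *-congˡ (inverseʳ y y≉0) ⟨
      x * (y * y ⁻¹)   ≈⟨ *-congˡ (*-comm y (y ⁻¹)) ⟩
      x * (y ⁻¹ * y)   ≈⟨ *-assoc x (y ⁻¹) y ⟨
      (x * y ⁻¹) * y   ≈⟨ *-congʳ xy⁻¹≈1 ⟩
      1# * y           ≈⟨ *-identityˡ y ⟩
      y                ∎
    from : x ≈ y → x * y ⁻¹ ≈ 1#
    from x≈y = trans (*-congʳ x≈y) (inverseʳ y y≉0)

  Σ-cong : ∀ n {f g : Fin n → Carrier} → (∀ i → f i ≈ g i) → Σ n f ≈ Σ n g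
  Σ-cong zero    f≈g = refl
  Σ-cong (suc n) f≈g = +-cong (f≈g zero) (Σ-cong n (λ i → f≈g (suc i)))

  Σ-mono-≤ : ∀ n {f g : Fin n → Carrier} → (∀ i → f i ≤ g i) → Σ n f ≤ Σ n g
  Σ-mono-≤ zero    f≤g = ≤-refl
  Σ-mono-≤ (suc n) f≤g = +-mono-≤ (f≤g zero) (Σ-mono-≤ n (λ i → f≤g (suc i)))

  Σ-const : ∀ n x → Σ n (λ _ → x) ≈ fromℕ n * x
  Σ-const zero    x = sym (zeroˡ x)
  Σ-const (suc n) x = begin
    x + Σ n (λ _ → x)      ≈⟨ +-cong (sym (*-identityˡ x)) (Σ-const n x) ⟩
    1# * x + fromℕ n * x   ≈⟨ distribʳ x 1# (fromℕ n) ⟨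
    (1# + fromℕ n) * x     ∎
    where open ≈-Reasoning

  Σ-0 : ∀ n → Σ n (λ _ → 0#) ≈ 0#
  Σ-0 n = trans (Σ-const n 0#) (zeroʳ (fromℕ n))

  Σ-nonneg : ∀ n {f : Fin n → Carrier} → (∀ i → 0# ≤ f i) → 0# ≤ Σ n f
  Σ-nonneg n 0≤f = ≤-trans (≤-reflexive (sym (Σ-0 n))) (Σ-mono-≤ n 0≤f)

  Σ-distrib-+ : ∀ n (f g : Fin n → Carrier) → Σ n (λ i → f i + g i) ≈ Σ n f + Σ n g
  Σ-distrib-+ zero    f g = sym (+-identityˡ 0#)
  Σ-distrib-+ (suc n) f g =
    trans (+-congˡ (Σ-distrib-+ n (λ i → f (suc i)) (λ i → g (suc i)))) (interchange (f zero) (g zero) _ _)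

  *-distribʳ-Σ : ∀ n x (f : Fin n → Carrier) → Σ n f * x ≈ Σ n (λ i → f i * x)
  *-distribʳ-Σ zero    x f = zeroˡ x
  *-distribʳ-Σ (suc n) x f =
    trans (distribʳ x (f zero) _) (+-congˡ (*-distribʳ-Σ n x (λ i → f (suc i))))

  Σ-comm : ∀ a b (f : Fin a → Fin b → Carrier) →
           Σ a (λ x → Σ b (f x)) ≈ Σ b (λ y → Σ a (λ x → f x y))
  Σ-comm zero    b f = sym (Σ-0 b)
  Σ-comm (suc a) b f = trans (+-congˡ (Σ-comm a b (λ x → f (suc x))))
                             (sym (Σ-distrib-+ b (f zero) (λ y → Σ a (λ x → f (suc x) y))))

  ≤-Σ : ∀ n {f : Fin n → Carrier} → (∀ i → 0# ≤ f i) → ∀ i → f i ≤ Σ n f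
  ≤-Σ (suc n) {f} 0≤f zero = begin
    f zero                   ≈⟨ +-identityʳ (f zero) ⟨
    f zero + 0#              ≤⟨ +-mono-≤ ≤-refl (Σ-nonneg n (λ i → 0≤f (suc i))) ⟩
    Σ (suc n) f              ∎
    where open ≤-Reasoning
  ≤-Σ (suc n) {f} 0≤f (suc i) = begin
    f (suc i)                ≈⟨ +-identityˡ (f (suc i)) ⟨
    0# + f (suc i)           ≤⟨ +-mono-≤ (0≤f zero) (≤-Σ n (λ i → 0≤f (suc i)) i) ⟩
    Σ (suc n) f              ∎
    where open ≤-Reasoning

  Σ≈0⇒≈0 : ∀ n {f : Fin n → Carrier} → (∀ i → 0# ≤ f i) → Σ n f ≈ 0# → ∀ i → f i ≈ 0#
  Σ≈0⇒≈0 n 0≤f Σf≈0 i = ≤-antisym (≤-trans (≤-Σ n 0≤f i) (≤-reflexive Σf≈0)) (0≤f i)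

  min₂-selective : ∀ x y → min₂ x y ≡ x ⊎ min₂ x y ≡ y
  min₂-selective x y with total x y
  ... | inj₁ _ = inj₁ ≡.refl
  ... | inj₂ _ = inj₂ ≡.refl

  min₂-≤ˡ : ∀ x y → min₂ x y ≤ x
  min₂-≤ˡ x y with total x y
  ... | inj₁ _   = ≤-refl
  ... | inj₂ y≤x = y≤x

  min₂-≤ʳ : ∀ x y → min₂ x y ≤ y
  min₂-≤ʳ x y with total x y
  ... | inj₁ x≤y = x≤y
  ... | inj₂ _   = ≤-refl

  minimum-≤ : ∀ m (f : Fin (suc m) → Carrier) i → minimum m f ≤ f i
  minimum-≤ zero    f zero    = ≤-refl
  minimum-≤ (suc m) f zero    = min₂-≤ˡ _ _
  minimum-≤ (suc m) f (suc i) = ≤-trans (min₂-≤ʳ _ _) (minimum-≤ m (λ i → f (suc i)) i)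

  minimum-attained : ∀ m (f : Fin (suc m) → Carrier) → ∃[ i ] minimum m f ≡ f i
  minimum-attained zero    f = zero , ≡.refl
  minimum-attained (suc m) f with min₂-selective (f zero) (minimum m (λ i → f (suc i)))
  ... | inj₁ eq = zero , eq
  ... | inj₂ eq with minimum-attained m (λ i → f (suc i))
  ...   | i , eq′ = suc i , ≡.trans eq eq′

module WeightedSums {c ℓ} (F : OrderedField c ℓ) {a m : ℕ}
                    (w : Fin a → Fin (suc m) → OrderedField.Carrier F) where
  open OrderedField F
  open OrderedFieldProperties F
  open CommutativeSemigroupProperties *-commutativeSemigroup using (xy∙z≈xz∙y)

  totalWeight : Carrier
  totalWeight = Σ a (λ x → Σ (suc m) (w x))

  columnWeight : Fin (suc m) → Carrier
  columnWeight y = Σ a (λ x → w x y)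

  weightedSum : (Fin (suc m) → Carrier) → Carrier
  weightedSum K = Σ a (λ x → Σ (suc m) (λ y → w x y * K y))

  weightedSum-const : ∀ {K k} → (∀ y → K y ≈ k) → weightedSum K ≈ totalWeight * k
  weightedSum-const {K} {k} K≈k = begin
    weightedSum K                              ≈⟨ Σ-cong a (λ x → Σ-cong (suc m) (λ y → *-congˡ {w x y} (K≈k y))) ⟩
    Σ a (λ x → Σ (suc m) (λ y → w x y * k))    ≈⟨ Σ-cong a (λ x → *-distribʳ-Σ (suc m) k (w x)) ⟨
    Σ a (λ x → Σ (suc m) (w x) * k)            ≈⟨ *-distribʳ-Σ a k (λ x → Σ (suc m) (w x)) ⟨
    totalWeight * k                            ∎
    where open ≈-Reasoning

  weightedSum-split : ∀ K k →
    weightedSum K ≈ totalWeight * k + Σ (suc m) (λ y → columnWeight y * (K y - k))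
  weightedSum-split K k = begin
    weightedSum K
      ≈⟨ Σ-cong a (λ x → Σ-cong (suc m) (λ y → split (w x y) (K y))) ⟩
    Σ a (λ x → Σ (suc m) (λ y → w x y * k + w x y * (K y - k)))
      ≈⟨ Σ-cong a (λ x → Σ-distrib-+ (suc m) (λ y → w x y * k) (λ y → w x y * (K y - k))) ⟩
    Σ a (λ x → Σ (suc m) (λ y → w x y * k) + Σ (suc m) (λ y → w x y * (K y - k)))
      ≈⟨ Σ-distrib-+ a _ _ ⟩
    weightedSum (λ _ → k) + Σ a (λ x → Σ (suc m) (λ y → w x y * (K y - k)))
      ≈⟨ +-cong (weightedSum-const (λ _ → refl)) (Σ-comm a (suc m) (λ x y → w x y * (K y - k))) ⟩
    totalWeight * k + Σ (suc m) (λ y → Σ a (λ x → w x y * (K y - k)))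
      ≈⟨ +-congˡ (Σ-cong (suc m) (λ y → *-distribʳ-Σ a (K y - k) (λ x → w x y))) ⟨
    totalWeight * k + Σ (suc m) (λ y → columnWeight y * (K y - k)) ∎
    where
    open ≈-Reasoning
    split : ∀ v x → v * x ≈ v * k + v * (x - k)
    split v x = begin
      v * x               ≈⟨ *-congˡ (x-y+y≈x x k) ⟨
      v * ((x - k) + k)   ≈⟨ *-congˡ (+-comm (x - k) k) ⟩
      v * (k + (x - k))   ≈⟨ distribˡ v k (x - k) ⟩
      v * k + v * (x - k) ∎

  module _ (0≤w : ∀ x y → 0# ≤ w x y) where

    private
      0≤residual : ∀ K y → 0# ≤ (columnWeight y * (K y - minimum m K))
      0≤residual K y = *-nonneg (Σ-nonneg a (λ x → 0≤w x y)) (x≤y⇒0≤y-x (minimum-≤ m K y))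

    totalWeight*minimum≤weightedSum : ∀ K → (totalWeight * minimum m K) ≤ weightedSum K
    totalWeight*minimum≤weightedSum K = begin
      totalWeight * k        ≈⟨ +-identityʳ _ ⟨
      totalWeight * k + 0#   ≤⟨ +-mono-≤ ≤-refl (Σ-nonneg (suc m) (0≤residual K)) ⟩
      totalWeight * k + Σ (suc m) (λ y → columnWeight y * (K y - k))
                             ≈⟨ weightedSum-split K k ⟨
      weightedSum K          ∎
      where
      open ≤-Reasoning
      k : Carrier
      k = minimum m K

    weightedSum≈totalWeight*minimum⇒≈minimum : (∀ y → ¬ columnWeight y ≈ 0#) → ∀ K →
      weightedSum K ≈ totalWeight * minimum m K → ∀ y → K y ≈ minimum m K
    weightedSum≈totalWeight*minimum⇒≈minimum columnWeight≉0 K eq y =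
      x-y≈0⇒x≈y (*-cancelˡ-≈0 (columnWeight≉0 y)
        (Σ≈0⇒≈0 (suc m) (0≤residual K) residual≈0 y))
      where
      k : Carrier
      k = minimum m K
      residual≈0 : Σ (suc m) (λ y → columnWeight y * (K y - k)) ≈ 0#
      residual≈0 = x+y≈y⇒x≈0 (trans (+-comm _ _) (trans (sym (weightedSum-split K k)) eq))

    normalisedTotalWeight*minimum≤1 : (∀ y → ¬ columnWeight y ≈ 0#) →
      ∀ {D} → 0# ≤ D → ¬ D ≈ 0# → ∀ K → weightedSum K ≈ D →
      ((totalWeight * D ⁻¹) * minimum m K) ≤ 1#
        × ((totalWeight * D ⁻¹) * minimum m K ≈ 1# ⇔ IsConstant F K)
    normalisedTotalWeight*minimum≤1 columnWeight≉0 {D} 0≤D D≉0 K ΣK≈D =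
        ≤-trans (≤-reflexive rearrange)
          (x≤y⇒x*y⁻¹≤1 0≤D D≉0 (≤-trans (totalWeight*minimum≤weightedSum K) (≤-reflexive ΣK≈D)))
      , ⇔-trans (mk⇔ (trans (sym rearrange)) (trans rearrange))
          (⇔-trans (x*y⁻¹≈1⇔x≈y D≉0) (mk⇔ toConstant fromConstant))
      where
      k : Carrier
      k = minimum m K
      rearrange : (totalWeight * D ⁻¹) * k ≈ (totalWeight * k) * D ⁻¹
      rearrange = xy∙z≈xz∙y totalWeight (D ⁻¹) k
      toConstant : totalWeight * k ≈ D → IsConstant F K
      toConstant eq x y = trans (K≈k x) (sym (K≈k y))
        where
        K≈k : ∀ y → K y ≈ k
        K≈k = weightedSum≈totalWeight*minimum⇒≈minimum columnWeight≉0 K (trans ΣK≈D (sym eq))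
      fromConstant : IsConstant F K → totalWeight * k ≈ D
      fromConstant K-const with minimum-attained m K
      ... | i , k≡Ki =
        trans (sym (weightedSum-const (λ y → trans (K-const y i) (reflexive (≡.sym k≡Ki))))) ΣK≈D

module _ {n} (G : Graph n) where

  least-≥ : ∀ p start fuel → start ≤ℕ least G p start fuel
  least-≥ p start zero       = ℕ.≤-refl
  least-≥ p start (suc fuel) with p start
  ... | true  = ℕ.≤-refl
  ... | false = ℕ.≤-trans (ℕ.n≤1+n start) (least-≥ p (suc start) fuel)

  least-hit : ∀ p start fuel → p start ≡ true → least G p start (suc fuel) ≡ start
  least-hit p start fuel eq rewrite eq = ≡.refl

  least-skip : ∀ p start fuel → p start ≡ false → start <ℕ least G p start (suc fuel)
  least-skip p start fuel eq rewrite eq = least-≥ p (suc start) fuel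

module _ {m} (G : Graph (suc m)) where

  dist-refl : ∀ x → dist G x x ≡ 0
  dist-refl x = least-hit G (λ k → reach G k x x) 0 m
    (≡.trans (isYes≗does (x ≟ x)) (dec-true (x ≟ x) ≡.refl))

  dist-pos : ∀ {x y} → x ≢ y → 0 <ℕ dist G x y
  dist-pos {x} {y} x≢y = least-skip G (λ k → reach G k x y) 0 m
    (≡.trans (isYes≗does (x ≟ y)) (dec-false (x ≟ y) x≢y))

module _ {c ℓ} (F : OrderedField c ℓ) where
  open OrderedField F
  open OrderedFieldProperties F

  1≤distanceColumnSum : ∀ {m} (G : Graph (suc (suc m))) y →
                        1# ≤ Σ (suc (suc m)) (λ x → fromℕ (dist G x y))
  1≤distanceColumnSum {m} G y =
    ≤-trans (0<k⇒1≤fromℕ (dist-pos G (punchInᵢ≢i y zero)))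
            (≤-Σ (suc (suc m)) (λ x → 0≤fromℕ (dist G x y)) (punchIn y zero))

  1≤fromℕ-suc² : ∀ k → 1# ≤ (fromℕ (suc k) * fromℕ (suc k))
  1≤fromℕ-suc² k = begin
    1#      ≈⟨ *-identityʳ 1# ⟨
    1# * 1# ≤⟨ *-monoʳ-≤ 0≤1 1≤N ⟩
    N * 1#  ≤⟨ *-monoˡ-≤ (0≤fromℕ (suc k)) 1≤N ⟩
    N * N   ∎
    where
    open ≤-Reasoning
    N : Carrier
    N = fromℕ (suc k)
    1≤N : 1# ≤ N
    1≤N = 0<k⇒1≤fromℕ {suc k} (s≤s z≤n)

proposition5p6 : ∀ {c ℓ} (F : OrderedField c ℓ) (m : ℕ) (G : Graph (suc m)) →
    Connected G →
    (K : Fin (suc m) → OrderedField.Carrier F) →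
    (∀ x → OrderedField._≤_ F (OrderedField.0# F) (K x)) →
    (∀ x → OrderedField._≈_ F
             (OrderedField.Σ F (suc m) (λ y → OrderedField._*_ F (OrderedField.fromℕ F (dist G x y)) (K y)))
             (OrderedField.fromℕ F (suc m))) →
    OrderedField._≤_ F
      (OrderedField._*_ F (avgDist F G) (OrderedField.minimum F m K))
      (OrderedField.1# F)
    × (OrderedField._≈_ F
         (OrderedField._*_ F (avgDist F G) (OrderedField.minimum F m K))
         (OrderedField.1# F)
       ⇔ IsConstant F K)
-- On a single vertex the
-- hypothesis reads 0 · K 0 = 1.
proposition5p6 F zero G _ K _ H = ⊥-elim (0≉1 (begin
    0#                                         ≈⟨ +-identityʳ _ ⟨
    0# + 0#                                    ≈⟨ +-congʳ (zeroˡ (K zero)) ⟨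
    0# * K zero + 0#                           ≡⟨ ≡.cong (λ d → fromℕ d * K zero + 0#) (dist-refl G zero) ⟨
    Σ 1 (λ y → fromℕ (dist G zero y) * K y)    ≈⟨ H zero ⟩
    1# + 0#                                    ≈⟨ +-identityʳ 1# ⟩
    1#                                         ∎))
  where
  open OrderedField F
  open OrderedFieldProperties F
  open ≈-Reasoning
proposition5p6 F (suc m) G _ K _ H =
  normalisedTotalWeight*minimum≤1 (λ x y → 0≤fromℕ (dist G x y))
    (λ y → 1≤x⇒x≉0 (1≤distanceColumnSum F G y))
    (≤-trans 0≤1 (1≤fromℕ-suc² F (suc m))) (1≤x⇒x≉0 (1≤fromℕ-suc² F (suc m)))
    K (trans (Σ-cong (suc (suc m)) H) (Σ-const (suc (suc m)) (fromℕ (suc (suc m)))))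
  where
  open OrderedField F
  open OrderedFieldProperties F
  open WeightedSums F (λ x y → fromℕ (dist G x y))
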